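{- Let $k$ be a positive integer and let $(x,y)$ be a vertex of the hexagonal grid $G_H$ with $x+y$ even. Then for each vertex $v$ in $$\{(x-k+2j,\,y+k+1): j=0,1,\ldots,k\}\cup\{(x-k-1+2j,\,y-k): j=0,1,\ldots,k+1\}$$ there exists a path of length $2k+1$ in $G_H$ from $(x,y)$ to $v$.
   Context: The hexagonal grid $G_H$ (brick-wall representation) has vertex set $\mathbb{Z}\times\mathbb{Z}$; every vertex $(x,y)$ is adjacent to $(x-1,y)$ and $(x+1,y)$, and additionally to $(x,y+1)$ if $x+y$ is even, and to $(x,y-1)$ if $x+y$ is odd. -}

module Defs where

open import Data.Integer using (ℤ; _+_; _-_; +_; 1ℤ)
open import Data.Nat using (ℕ; suc)
open import Data.Product using (_×_; _,_; ∃)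
open import Data.List using (List; []; _∷_; length)
open import Data.List.Relation.Unary.Unique.Propositional using (Unique)
open import Relation.Binary.PropositionalEquality using (_≡_)

IsEven : ℤ → Set
IsEven z = ∃ λ m → z ≡ m + m

IsOdd : ℤ → Set
IsOdd z = ∃ λ m → z ≡ 1ℤ + (m + m)

-- vertices of the hexagonal grid G_H (brick-wall representation)
Vertex : Set
Vertex = ℤ × ℤ

data Adj : Vertex → Vertex → Set where
  left  : ∀ x y → Adj (x , y) (x - 1ℤ , y)
  right : ∀ x y → Adj (x , y) (x + 1ℤ , y)
  up    : ∀ x y → IsEven (x + y) → Adj (x , y) (x , y + 1ℤ)
  down  : ∀ x y → IsOdd  (x + y) → Adj (x , y) (x , y - 1ℤ)

data WalkVs : Vertex → Vertex → List Vertex → Set where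
  here : ∀ u → WalkVs u u (u ∷ [])
  step : ∀ {u w v vs} → Adj u w → WalkVs w v vs → WalkVs u v (u ∷ vs)

-- a path of length n from u to v: a walk with pairwise distinct vertices
-- having n edges (i.e. n + 1 vertices)
PathOfLength : ℕ → Vertex → Vertex → Set
PathOfLength n u v =
  ∃ λ (vs : List Vertex) → WalkVs u v vs × Unique vs × length vs ≡ suc n

-- From an even vertex the only vertical edge goes up, and every horizontal
-- edge leads to an odd vertex, whose only vertical edge goes down.  Hence:
--   * an ASCENDING STAIRCASE alternates "up, sideways" and ends with "up":
--     with k sideways moves it has 2k+1 edges and ends on row y + k + 1;
--   * a DESCENDING STAIRCASE alternates "sideways, down" and ends with
--     "sideways": with k+1 sideways moves it has 2k+1 edges and ends on
--     row y - k.
-- Each sideways move may go left or right, so a staircase is described by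
-- a list of directions, and its horizontal displacement is the number of
-- right moves minus the number of left moves.  Staircases are paths because
-- their rows are monotone and the two vertices of a row differ in x.
module Submission where

open import Defs
open import Data.Nat using (ℕ; suc; _≤_; _∸_) renaming (_+_ to _+ℕ_; _*_ to _*ℕ_)
open import Data.Integer using (ℤ; _+_; _-_; _*_; +_)

open import Data.Bool using (Bool; true; false)
open import Data.Integer using (1ℤ; -1ℤ; _<_) renaming (_≤_ to _≤ℤ_)
open import Data.Integer.Properties
  using (+-comm; +-identityʳ; <⇒≢; <⇒≤; <-trans; ≤-refl; ≤-reflexive; ≤-<-trans;
         suc[i]≤j⇒i<j; i≤pred[j]⇒i<j; i≢suc[i])
open import Data.Integer.Tactic.RingSolver using (solve-∀)
open import Data.List using (List; []; _∷_; length; replicate; _++_)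
open import Data.List.Properties using (length-++; length-replicate)
open import Data.List.Relation.Unary.All as All using (All; []; _∷_)
open import Data.List.Relation.Unary.AllPairs using ([]; _∷_)
open import Data.List.Relation.Unary.Unique.Propositional using (Unique)
import Data.Nat.Properties as ℕ
open import Data.Product using (_×_; _,_; ∃; proj₁; proj₂)
open import Function using (_∘_)
open import Relation.Binary.PropositionalEquality

shift : Bool → ℤ → ℤ
shift true  z = z + 1ℤ
shift false z = z - 1ℤ

drift : List Bool → ℤ → ℤ
drift []       a = a
drift (d ∷ ds) a = drift ds (shift d a)

i<i+1 : ∀ i → i < i + 1ℤ
i<i+1 i = subst (i <_) (+-comm 1ℤ i) (suc[i]≤j⇒i<j ≤-refl)

i-1<i : ∀ i → i - 1ℤ < i
i-1<i i = i≤pred[j]⇒i<j (≤-reflexive (+-comm i -1ℤ))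

shift-≢ : ∀ d a → a ≢ shift d a
shift-≢ true  a eq = i≢suc[i] (trans eq (+-comm a 1ℤ))
shift-≢ false a eq = <⇒≢ (i-1<i a) (sym eq)

sideways : ∀ d a b → Adj (a , b) (shift d a , b)
sideways true  a b = right a b
sideways false a b = left a b

even⇒odd-shift : ∀ d {z} → IsEven z → IsOdd (shift d z)
even⇒odd-shift true  (m , e) = m , trans (cong (_+ 1ℤ) e) (+-comm (m + m) 1ℤ)
even⇒odd-shift false (m , e) = m - 1ℤ , trans (cong (_- 1ℤ) e) (lemma m)
  where
  lemma : ∀ m → (m + m) - 1ℤ ≡ 1ℤ + ((m - 1ℤ) + (m - 1ℤ))
  lemma = solve-∀

odd⇒even-shift : ∀ d {z} → IsOdd z → IsEven (shift d z)
odd⇒even-shift true  (m , e) = m + 1ℤ , trans (cong (_+ 1ℤ) e) (lemma m)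
  where
  lemma : ∀ m → (1ℤ + (m + m)) + 1ℤ ≡ (m + 1ℤ) + (m + 1ℤ)
  lemma = solve-∀
odd⇒even-shift false (m , e) = m , trans (cong (_- 1ℤ) e) (lemma m)
  where
  lemma : ∀ m → (1ℤ + (m + m)) - 1ℤ ≡ m + m
  lemma = solve-∀

shift-+ˡ : ∀ d a b → shift d a + b ≡ shift d (a + b)
shift-+ˡ true  = lemma
  where
  lemma : ∀ a b → (a + 1ℤ) + b ≡ (a + b) + 1ℤ
  lemma = solve-∀
shift-+ˡ false = lemma
  where
  lemma : ∀ a b → (a - 1ℤ) + b ≡ (a + b) - 1ℤ
  lemma = solve-∀

shift-+ʳ : ∀ d a b → a + shift d b ≡ shift d (a + b)
shift-+ʳ true  = lemma
  where
  lemma : ∀ a b → a + (b + 1ℤ) ≡ (a + b) + 1ℤ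
  lemma = solve-∀
shift-+ʳ false = lemma
  where
  lemma : ∀ a b → a + (b - 1ℤ) ≡ (a + b) - 1ℤ
  lemma = solve-∀

even⇒odd-x : ∀ d a b → IsEven (a + b) → IsOdd (shift d a + b)
even⇒odd-x d a b = subst IsOdd (sym (shift-+ˡ d a b)) ∘ even⇒odd-shift d

odd⇒even-x : ∀ d a b → IsOdd (a + b) → IsEven (shift d a + b)
odd⇒even-x d a b = subst IsEven (sym (shift-+ˡ d a b)) ∘ odd⇒even-shift d

even⇒odd-y : ∀ d a b → IsEven (a + b) → IsOdd (a + shift d b)
even⇒odd-y d a b = subst IsOdd (sym (shift-+ʳ d a b)) ∘ even⇒odd-shift d

odd⇒even-y : ∀ d a b → IsOdd (a + b) → IsEven (a + shift d b)
odd⇒even-y d a b = subst IsEven (sym (shift-+ʳ d a b)) ∘ odd⇒even-shift d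

sideways-≢ : ∀ d a (b : ℤ) → (a , b) ≢ (shift d a , b)
sideways-≢ d a b eq = shift-≢ d a (cong proj₁ eq)

fresh-row : ∀ {a b} {ws : List Vertex} →
  All (λ w → b ≢ proj₂ w) ws → All ((a , b) ≢_) ws
fresh-row = All.map (λ b≢y eq → b≢y (cong proj₂ eq))

walk-to : ∀ {u v v′ vs} → v ≡ v′ → WalkVs u v vs → WalkVs u v′ vs
walk-to refl walk = walk

two-more-edges : ∀ n → 2 +ℕ (2 *ℕ n +ℕ 1) ≡ 2 *ℕ suc n +ℕ 1
two-more-edges n = cong (_+ℕ 1) (sym (ℕ.*-suc 2 n))

-- All vertices after
-- the first lie strictly above row b, which makes the staircase a path.
ascend : ∀ (ds : List Bool) a b → IsEven (a + b) →
  ∃ λ ts → WalkVs (a , b) (drift ds a , (b + + length ds) + 1ℤ) ((a , b) ∷ ts)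
         × Unique ((a , b) ∷ ts)
         × length ts ≡ 2 *ℕ length ds +ℕ 1
         × All (λ w → b < proj₂ w) ts
ascend [] a b ev =
  (a , b + 1ℤ) ∷ [] ,
  walk-to (cong (λ v → a , v + 1ℤ) (sym (+-identityʳ b))) (step (up a b ev) (here _)) ,
  (fresh-row (<⇒≢ (i<i+1 b) ∷ []) ∷ [] ∷ []) ,
  refl ,
  i<i+1 b ∷ []
ascend (d ∷ ds) a b ev
  with ascend ds (shift d a) (b + 1ℤ) (odd⇒even-x d a (b + 1ℤ) (even⇒odd-y true a b ev))
... | ts , walk , unique , len , above =
  (a , b + 1ℤ) ∷ (shift d a , b + 1ℤ) ∷ ts ,
  walk-to (cong (drift ds (shift d a) ,_) (next-row b (+ length ds)))
    (step (up a b ev) (step (sideways d a (b + 1ℤ)) walk)) ,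
  (fresh-row (All.map <⇒≢ above-b) ∷
    (sideways-≢ d a (b + 1ℤ) ∷ fresh-row (All.map <⇒≢ above)) ∷ unique) ,
  trans (cong (2 +ℕ_) len) (two-more-edges (length ds)) ,
  above-b
  where
  next-row : ∀ b n → ((b + 1ℤ) + n) + 1ℤ ≡ (b + (1ℤ + n)) + 1ℤ
  next-row = solve-∀
  above-b : All (λ w → b < proj₂ w) ((a , b + 1ℤ) ∷ (shift d a , b + 1ℤ) ∷ ts)
  above-b = i<i+1 b ∷ i<i+1 b ∷ All.map (<-trans (i<i+1 b)) above

-- No
-- vertex lies above row b, and the two vertices on row b differ in x.
descend : ∀ d (ds : List Bool) a b → IsEven (a + b) →
  ∃ λ vs → WalkVs (a , b) (drift (d ∷ ds) a , b - + length ds) vs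
         × Unique vs
         × length vs ≡ suc (2 *ℕ length ds +ℕ 1)
         × All (λ w → proj₂ w ≤ℤ b) vs
descend d [] a b ev =
  (a , b) ∷ (shift d a , b) ∷ [] ,
  walk-to (cong (shift d a ,_) (sym (+-identityʳ b))) (step (sideways d a b) (here _)) ,
  ((sideways-≢ d a b ∷ []) ∷ [] ∷ []) ,
  refl ,
  ≤-refl ∷ ≤-refl ∷ []
descend d (d′ ∷ ds) a b ev
  with descend d′ ds (shift d a) (b - 1ℤ) (odd⇒even-y false (shift d a) b (even⇒odd-x d a b ev))
... | vs , walk , unique , len , below =
  (a , b) ∷ (shift d a , b) ∷ vs ,
  walk-to (cong (drift (d′ ∷ ds) (shift d a) ,_) (next-row b (+ length ds)))
    (step (sideways d a b) (step (down (shift d a) b (even⇒odd-x d a b ev)) walk)) ,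
  ((sideways-≢ d a b ∷ fresh-row strictly-below) ∷
    fresh-row strictly-below ∷ unique) ,
  trans (cong (2 +ℕ_) len) (cong suc (two-more-edges (length ds))) ,
  ≤-refl ∷ ≤-refl ∷ All.map (<⇒≤ ∘ lower) below
  where
  next-row : ∀ b n → (b - 1ℤ) - n ≡ b - (1ℤ + n)
  next-row = solve-∀
  lower : ∀ {y} → y ≤ℤ b - 1ℤ → y < b
  lower y≤ = ≤-<-trans y≤ (i-1<i b)
  strictly-below : All (λ w → b ≢ proj₂ w) vs
  strictly-below = All.map (λ y≤ eq → <⇒≢ (lower y≤) (sym eq)) below

ascending-path : ∀ {k} (ds : List Bool) a b → IsEven (a + b) → length ds ≡ k →
  PathOfLength (2 *ℕ k +ℕ 1) (a , b) (drift ds a , (b + + k) + + 1)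
ascending-path ds a b ev refl with ascend ds a b ev
... | ts , walk , unique , len , _ = (a , b) ∷ ts , walk , unique , cong suc len

descending-path : ∀ {k} (ds : List Bool) a b → IsEven (a + b) → length ds ≡ suc k →
  PathOfLength (2 *ℕ k +ℕ 1) (a , b) (drift ds a , b - + k)
descending-path (d ∷ ds) a b ev refl with descend d ds a b ev
... | vs , walk , unique , len , _ = vs , walk , unique , len

lefts-then-rights : ℕ → ℕ → List Bool
lefts-then-rights m n = replicate m false ++ replicate n true

length-lefts-then-rights : ∀ m n → length (lefts-then-rights m n) ≡ m +ℕ n
length-lefts-then-rights m n =
  trans (length-++ (replicate m false))
        (cong₂ _+ℕ_ (length-replicate m) (length-replicate n))

drift-rights : ∀ n a → drift (replicate n true) a ≡ a + + n
drift-rights 0       a = sym (+-identityʳ a)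
drift-rights (suc n) a = trans (drift-rights n (a + 1ℤ)) (lemma a (+ n))
  where
  lemma : ∀ a n → (a + 1ℤ) + n ≡ a + (1ℤ + n)
  lemma = solve-∀

-- The displacement of m lefts and n rights, written relative to the
-- leftmost point a - (m + n) of the row it lands on.
drift-lefts-then-rights : ∀ m n {k} a → m +ℕ n ≡ k →
  drift (lefts-then-rights m n) a ≡ (a - + k) + + 2 * + n
drift-lefts-then-rights 0 n a refl = trans (drift-rights n a) (lemma a (+ n))
  where
  lemma : ∀ a n → a + n ≡ (a - n) + + 2 * n
  lemma = solve-∀
drift-lefts-then-rights (suc m) n a refl =
  trans (drift-lefts-then-rights m n (a - 1ℤ) refl) (lemma a (+ (m +ℕ n)) (+ n))
  where
  lemma : ∀ a k n → ((a - 1ℤ) - k) + + 2 * n ≡ (a - (1ℤ + k)) + + 2 * n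
  lemma = solve-∀

top-row : ∀ k j x y → j ≤ k → IsEven (x + y) →
  PathOfLength (2 *ℕ k +ℕ 1) (x , y) ((x - + k) + + 2 * + j , (y + + k) + + 1)
top-row k j x y j≤k ev =
  subst (λ v → PathOfLength _ (x , y) (v , _))
    (drift-lefts-then-rights (k ∸ j) j x k-j+j≡k)
    (ascending-path (lefts-then-rights (k ∸ j) j) x y ev
      (trans (length-lefts-then-rights (k ∸ j) j) k-j+j≡k))
  where
  k-j+j≡k : (k ∸ j) +ℕ j ≡ k
  k-j+j≡k = ℕ.m∸n+n≡m j≤k

bottom-row : ∀ k j x y → j ≤ suc k → IsEven (x + y) →
  PathOfLength (2 *ℕ k +ℕ 1) (x , y) (((x - + k) - + 1) + + 2 * + j , y - + k)
bottom-row k j x y j≤k+1 ev =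
  subst (λ v → PathOfLength _ (x , y) (v , _))
    (trans (drift-lefts-then-rights (suc k ∸ j) j x m+j≡k+1) (regroup x (+ k) (+ j)))
    (descending-path (lefts-then-rights (suc k ∸ j) j) x y ev
      (trans (length-lefts-then-rights (suc k ∸ j) j) m+j≡k+1))
  where
  m+j≡k+1 : (suc k ∸ j) +ℕ j ≡ suc k
  m+j≡k+1 = ℕ.m∸n+n≡m j≤k+1
  regroup : ∀ x k j → (x - (1ℤ + k)) + + 2 * j ≡ ((x - k) - + 1) + + 2 * j
  regroup = solve-∀

-- The theorem: both rows at once.
claim6 : (k : ℕ) → 1 ≤ k → (x y : ℤ) → IsEven (x + y) →
    ((j : ℕ) → j ≤ k →
      PathOfLength (2 *ℕ k +ℕ 1) (x , y) ((x - + k) + + 2 * + j , (y + + k) + + 1))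
    × ((j : ℕ) → j ≤ suc k →
      PathOfLength (2 *ℕ k +ℕ 1) (x , y) (((x - + k) - + 1) + + 2 * + j , y - + k))
claim6 k _ x y ev =
  (λ j j≤k → top-row k j x y j≤k ev) , (λ j j≤k+1 → bottom-row k j x y j≤k+1 ev)
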